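{- Let $B$ be a long $p$-chain that is a child branch of the root (depot) $r$. Then $B$ can be resolved at the root: there is a set of tours that covers all demand of $B$ and whose total cost is at most $4/3$ times the reduction in the lower bound $LB$ that results from removing the demand of $B$.
   Context: Setting: Capacitated Vehicle Routing on a tree $T$ rooted at the depot $r$, with edge lengths $l(e)\ge 0$; demands are scaled so that the vehicle capacity is $Q=1$. For an edge $e=(u,v)$ ($u$ the parent of $v$), $T_v$ is the subtree rooted at $v$, $d(T_v)$ its total demand, the traffic is $f(e)=\lceil d(T_v)\rceil$, and the lower bound is $LB=\sum_{e}2\,l(e)\,f(e)$. $P[u,v]$ is the tree path from $u$ to $v$ and $l(P[u,v])$ its length. A branch at $u$ is $T_v$ together with its stem $(u,v)$; a $p$-branch is a branch whose stem has traffic $p$. A branch is resolved if all its demand is covered by a set of tours whose total cost is at most $4/3$ times the reduction in $LB$ caused by removing that demand. A branch is simplified if only leaves carry demand, every leaf has demand strictly between $0$ and $1$, no non-root vertex has degree two, and none of the following operations applies: Condense (an edge $(u,v)$ with traffic 1 and $v$ not a leaf is replaced, together with $T_v$, by a single edge to a new leaf of demand $d(T_v)$ and length equal to the total length of $(u,v)$ and $T_v$); Unzip (if the traffic of $(u,v)$ equals the sum of traffics of its child edges $(v,w_i)$, delete $v$ and add edges $(u,w_i)$ of length $l(u,v)+l(v,w_i)$); Group (if $u$ has at least four children including three leaf children $v_1,v_2,v_3$ with $1.5<d(v_1)+d(v_2)+d(v_3)<2$, add a new child $u'$ of $u$ via a zero-length edge and make $v_1,v_2,v_3$ children of $u'$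 with their original edge lengths); Unite (if $u$ has leaf children $v_1,v_2$ with $d(v_1)+d(v_2)\le 1$, replace them by one leaf of demand $d(v_1)+d(v_2)$ joined to $u$ by an edge of length $l(u,v_1)+l(u,v_2)$); Slide (if $e_0=(u,v)$ has child edges $e_1=(v,w_1)$, $e_2=(v,w_2)$ with $f(e_0)=f(e_1)$, delete $e_2$ and add edge $(w_1,w_2)$ of length $l(e_2)$). A 2-chain is a simplified 2-branch with stem $e_2^0=(u,v_2^0)$ such that $v_2^0$ has exactly three children $v_1^0,v_1^1,v_1^2$, all leaves, with total demand in $(1.5,2]$, labeled so that $l(e_1^0)\ge l(e_1^1)\ge l(e_1^2)$, where $e_i^j$ denotes the parent edge of $v_i^j$. For $p\ge 3$, a $p$-chain is a simplified $p$-branch with stem $e_p^0=(u,v_p^0)$ such that $v_p^0$ has exactly three children $v_{p-1}^0,v_{p-1}^1,v_{p-1}^2$, where $e_{p-1}^0$ is the stem of a $(p-1)$-chain and $v_{p-1}^1,v_{p-1}^2$ are leaves with $1<d(v_{p-1}^1)+d(v_{p-1}^2)\le 1.5$ and $l(e_{p-1}^1)\ge l(e_{p-1}^2)$. All 2-chains are long; for $p\ge 3$ a $p$-chain is long if $l(e_{p-1}^2)<l(P[v_p^0,r])$ and $e_{p-1}^0$ is the stem of a long $(p-1)$-chain.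
   Formalization: The edge lengths $l(e)$ and the demands are rational, and the amounts delivered by the tours are taken in the rationals. -}

module Defs where

open import Data.Nat as ℕ using (ℕ; zero; suc)
open import Data.Integer as ℤ using (ℤ; +_)
open import Data.Rational using (ℚ; 0ℚ; 1ℚ; _+_; _*_; _-_; _≤_; _<_; ceiling; _/_)
open import Data.List using (List; []; _∷_; map; length)
open import Data.List.Properties using (≡-dec)
open import Data.List.Relation.Binary.Permutation.Propositional using (_↭_)
open import Data.Product using (_×_; _,_; proj₁; proj₂; ∃; ∃-syntax)
open import Data.Maybe using (Maybe; just; nothing)
open import Data.Unit using (⊤)
open import Data.Empty using (⊥)
open import Relation.Nullary using (¬_; yes; no)
open import Relation.Binary.PropositionalEquality using (_≡_; _≢_)

data Tree : Set where
  node : ℚ → List (ℚ × Tree) → Tree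

-- a branch = stem length together with the subtree T_v hanging below it
Branch : Set
Branch = ℚ × Tree

dem : Tree → ℚ
dem (node q _) = q

children : Tree → List Branch
children (node _ cs) = cs

IsLeaf : Tree → Set
IsLeaf t = children t ≡ []

len : Branch → ℚ
len = proj₁

nth : {A : Set} → List A → ℕ → Maybe A
nth []       _       = nothing
nth (x ∷ _)  zero    = just x
nth (_ ∷ xs) (suc i) = nth xs i

sumℚ : List ℚ → ℚ
sumℚ []       = 0ℚ
sumℚ (x ∷ xs) = x + sumℚ xs

sumℤ : List ℤ → ℤ
sumℤ []       = + 0
sumℤ (x ∷ xs) = x ℤ.+ sumℤ xs

toℚ : ℤ → ℚ
toℚ z = z / 1

mutual
  total : Tree → ℚ
  total (node q cs) = q + totalL cs

  totalL : List Branch → ℚ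
  totalL []             = 0ℚ
  totalL ((_ , t) ∷ cs) = total t + totalL cs

dB : Branch → ℚ
dB (_ , t) = total t

traffic : Branch → ℤ
traffic (_ , t) = ceiling (total t)

mutual
  LB : Tree → ℚ
  LB (node _ cs) = LBL cs

  LBL : List Branch → ℚ
  LBL []             = 0ℚ
  LBL ((l , t) ∷ cs) = (+ 2 / 1) * l * toℚ (ceiling (total t)) + LB t + LBL cs

mutual
  NonNeg : Tree → Set
  NonNeg (node q cs) = (0ℚ ≤ q) × NonNegL cs

  NonNegL : List Branch → Set
  NonNegL []             = ⊤
  NonNegL ((l , t) ∷ cs) = (0ℚ ≤ l) × NonNeg t × NonNegL cs

mutual
  AllVert : (Tree → Set) → Tree → Set
  AllVert Q (node q cs) = Q (node q cs) × AllVertL Q cs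

  AllVertL : (Tree → Set) → List Branch → Set
  AllVertL Q []             = ⊤
  AllVertL Q ((_ , t) ∷ cs) = AllVert Q t × AllVertL Q cs

mutual
  AllEdge : (Branch → Set) → Branch → Set
  AllEdge P (l , node q cs) = P (l , node q cs) × AllEdgeL P cs

  AllEdgeL : (Branch → Set) → List Branch → Set
  AllEdgeL P []       = ⊤
  AllEdgeL P (e ∷ cs) = AllEdge P e × AllEdgeL P cs

CondenseApplies : Branch → Set
CondenseApplies (l , t) = (traffic (l , t) ≡ + 1) × ¬ IsLeaf t

UnzipApplies : Branch → Set
UnzipApplies (l , t) = traffic (l , t) ≡ sumℤ (map traffic (children t))

SlideApplies : Branch → Set
SlideApplies (l , t) =
  ∃[ j ] ∃[ k ] ∃[ e₁ ] ∃[ e₂ ]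
    (j ≢ k) × (nth (children t) j ≡ just e₁) × (nth (children t) k ≡ just e₂)
    × (traffic (l , t) ≡ traffic e₁)

GroupApplies : Tree → Set
GroupApplies t =
  (4 ℕ.≤ length (children t)) ×
  (∃[ j₁ ] ∃[ j₂ ] ∃[ j₃ ] ∃[ a ] ∃[ b ] ∃[ c ]
    (j₁ ≢ j₂) × (j₁ ≢ j₃) × (j₂ ≢ j₃)
    × (nth (children t) j₁ ≡ just a) × (nth (children t) j₂ ≡ just b)
    × (nth (children t) j₃ ≡ just c)
    × IsLeaf (proj₂ a) × IsLeaf (proj₂ b) × IsLeaf (proj₂ c)
    × ((+ 3 / 2) < dB a + dB b + dB c) × (dB a + dB b + dB c < + 2 / 1))

UniteApplies : Tree → Set
UniteApplies t =
  ∃[ j ] ∃[ k ] ∃[ a ] ∃[ b ]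
    (j ≢ k) × (nth (children t) j ≡ just a) × (nth (children t) k ≡ just b)
    × IsLeaf (proj₂ a) × IsLeaf (proj₂ b) × (dB a + dB b ≤ 1ℚ)

-- vertex conditions (every vertex of T_v is a non-root vertex)
VertexOK : Tree → Set
VertexOK t =
  (IsLeaf t → (0ℚ < dem t) × (dem t < 1ℚ)) × (¬ IsLeaf t → dem t ≡ 0ℚ)
  -- no (non-root) vertex of degree two, i.e. with exactly one child
  × (length (children t) ≢ 1)
  × ¬ GroupApplies t × ¬ UniteApplies t

EdgeOK : Branch → Set
EdgeOK e = ¬ CondenseApplies e × ¬ UnzipApplies e × ¬ SlideApplies e

Simplified : Branch → Set
Simplified (l , t) = AllEdge EdgeOK (l , t) × AllVert VertexOK t

LeafB : Branch → Set
LeafB e = IsLeaf (proj₂ e)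

Chain : ℕ → Branch → Set
Chain zero _ = ⊥
Chain (suc zero) _ = ⊥
Chain (suc (suc zero)) b =
  Simplified b × (traffic b ≡ + 2) ×
  (∃[ x₀ ] ∃[ x₁ ] ∃[ x₂ ]
     (children (proj₂ b) ↭ (x₀ ∷ x₁ ∷ x₂ ∷ []))
     × LeafB x₀ × LeafB x₁ × LeafB x₂
     × ((+ 3 / 2) < dB x₀ + dB x₁ + dB x₂) × (dB x₀ + dB x₁ + dB x₂ ≤ + 2 / 1)
     × (len x₁ ≤ len x₀) × (len x₂ ≤ len x₁))
Chain (suc (suc (suc k))) b =
  Simplified b × (traffic b ≡ + (suc (suc (suc k)))) ×
  (∃[ x₀ ] ∃[ x₁ ] ∃[ x₂ ]
     (children (proj₂ b) ↭ (x₀ ∷ x₁ ∷ x₂ ∷ []))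
     × Chain (suc (suc k)) x₀ × LeafB x₁ × LeafB x₂
     × (1ℚ < dB x₁ + dB x₂) × (dB x₁ + dB x₂ ≤ + 3 / 2)
     × (len x₂ ≤ len x₁))

-- LongChain p δ b : b is a long p-chain whose stem (u,v_p^0) has
-- l(P[u,r]) = δ; hence l(P[v_p^0,r]) = δ + len b.
LongChain : ℕ → ℚ → Branch → Set
LongChain zero _ _ = ⊥
LongChain (suc zero) _ _ = ⊥
LongChain (suc (suc zero)) δ b = Chain 2 b
LongChain (suc (suc (suc k))) δ b =
  Chain (suc (suc (suc k))) b ×
  (∃[ x₀ ] ∃[ x₁ ] ∃[ x₂ ]
     (children (proj₂ b) ↭ (x₀ ∷ x₁ ∷ x₂ ∷ []))
     × LeafB x₁ × LeafB x₂ × (len x₂ ≤ len x₁)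
     × (len x₂ < δ + len b)
     × LongChain (suc (suc k)) (δ + len b) x₀)

-- A vertex is addressed by the list of child indices from the root.
-- A tour is a list of deliveries (vertex, amount); its cost is the length of
-- the shortest closed walk from the depot through all its vertices, i.e.
-- 2 × (total length of the subtree spanned by the root and those vertices).

Addr : Set
Addr = List ℕ

Tour : Set
Tour = List (Addr × ℚ)

subtreeAt : Tree → Addr → Maybe Tree
subtreeAt t [] = just t
subtreeAt (node _ cs) (i ∷ a) with nth cs i
... | just (_ , t) = subtreeAt t a
... | nothing      = nothing

tailsWith : ℕ → List Addr → List Addr
tailsWith i [] = []
tailsWith i ([] ∷ as) = tailsWith i as
tailsWith i ((j ∷ a) ∷ as) with i ℕ.≟ j
... | yes _ = a ∷ tailsWith i as
... | no  _ = tailsWith i as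

mutual
  -- total length of the edges of t lying on a path from t's root to some address
  spanLen : Tree → List Addr → ℚ
  spanLen (node _ cs) as = spanLenL 0 cs as

  spanLenL : ℕ → List Branch → List Addr → ℚ
  spanLenL i []             as = 0ℚ
  spanLenL i ((l , t) ∷ cs) as = edgeLen l t (tailsWith i as) + spanLenL (suc i) cs as

  edgeLen : ℚ → Tree → List Addr → ℚ
  edgeLen l t []       = 0ℚ
  edgeLen l t (a ∷ as) = l + spanLen t (a ∷ as)

tourCost : Tree → Tour → ℚ
tourCost R τ = (+ 2 / 1) * spanLen R (map proj₁ τ)

deliveredTo : Addr → Tour → ℚ
deliveredTo a [] = 0ℚ
deliveredTo a ((b , x) ∷ τ) with ≡-dec ℕ._≟_ a b
... | yes _ = x + deliveredTo a τ
... | no  _ = deliveredTo a τ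

amounts : Tour → List ℚ
amounts = map proj₂

mutual
  AllDeliv : (Addr × ℚ → Set) → Tour → Set
  AllDeliv P [] = ⊤
  AllDeliv P (d ∷ τ) = P d × AllDeliv P τ

AllTours : (Tour → Set) → List Tour → Set
AllTours P [] = ⊤
AllTours P (τ ∷ τs) = P τ × AllTours P τs

-- a feasible tour (capacity Q = 1) delivering only to vertices of the
-- branch t hanging below child i of the root, with nonnegative amounts
TourInBranch : ℕ → Tree → Tour → Set
TourInBranch i t τ =
  AllDeliv (λ { (a , x) → (0ℚ ≤ x) ×
              (∃[ a' ] ∃[ w ] (a ≡ i ∷ a') × (subtreeAt t a' ≡ just w)) }) τ
  × (sumℚ (amounts τ) ≤ 1ℚ)

CoversBranch : ℕ → Tree → List Tour → Set
CoversBranch i t τs =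
  AllTours (TourInBranch i t) τs ×
  (∀ (a : Addr) (w : Tree) → subtreeAt t a ≡ just w →
     sumℚ (map (deliveredTo (i ∷ a)) τs) ≡ dem w)

mutual
  zeroDem : Tree → Tree
  zeroDem (node _ cs) = node 0ℚ (zeroDemL cs)

  zeroDemL : List Branch → List Branch
  zeroDemL [] = []
  zeroDemL ((l , t) ∷ cs) = (l , zeroDem t) ∷ zeroDemL cs

zeroChild : ℕ → List Branch → List Branch
zeroChild _ [] = []
zeroChild zero ((l , t) ∷ cs) = (l , zeroDem t) ∷ cs
zeroChild (suc i) (e ∷ cs) = e ∷ zeroChild i cs

removeBranchDemand : Tree → ℕ → Tree
removeBranchDemand (node q cs) i = node q (zeroChild i cs)

-- A long p-chain hanging at distance D below the depot, whose stem has traffic K, is served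
-- by tours of total cost at most 4/3 (2 K D + LB), by induction on p.  In a 2-chain no two of
-- the leaves x₀, x₁, x₂ fit into one vehicle (Unite does not apply), so the two tours
-- {x₀, x₂} and {x₁, x₂} serve it, splitting the demand of the nearest leaf x₂; they cost
-- 4D + 2(a₀ + a₁) + 4a₂ ≤ 4/3 (4D + 2(a₀ + a₁ + a₂)) since a₂ ≤ a₁ ≤ a₀ (aᵢ = len xᵢ).
-- For p ≥ 3 a full tour T serves the leaf x₁ and fills up at x₂; the rest of x₂ is
-- handed down to one distinguished tour of the (p-1)-chain, the carrier, which keeps
-- room for it.  The stem traffic grows by one, so the lower bound grows by at least
-- 2D + 2a₁ + 2a₂, and 4/3 of this pays for T and the carrier's detour 2a₂ because
-- a₂ ≤ a₁ and, the chain being long, a₂ ≤ D.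
module Submission where

open import Defs
open import Data.Nat using (ℕ)
open import Data.Integer using (+_)
open import Data.Rational using (ℚ; 0ℚ; _*_; _-_; _≤_; _/_)
open import Data.List using (List; map)
open import Data.Product using (_×_; _,_; ∃-syntax)
open import Data.Maybe using (just)
open import Relation.Binary.PropositionalEquality using (_≡_)

open import Algebra.Bundles using (CommutativeMonoid)
open import Data.Empty using (⊥-elim)
open import Data.Fin using (Fin; zero; suc; toℕ)
open import Data.Fin.Properties using (toℕ-injective)
open import Data.Integer as ℤ using (-[1+_])
import Data.Integer.DivMod as ℤ
import Data.Integer.Properties as ℤ
import Data.Integer.Solver as ℤSolver
open import Data.List as List using ([]; _∷_; _++_; concat; foldr; length; lookup)
import Data.List.Properties as List
open import Data.List.Relation.Binary.Permutation.Propositional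
  using (_↭_; prep; ↭-sym; ↭-trans; ↭-reflexive; ↭⇒↭ₛ; module PermutationReasoning)
open import Data.List.Relation.Binary.Permutation.Propositional.Properties
  using (map⁺; ++-comm; ++⁺ˡ; ∈-resp-↭; ↭-length)
import Data.List.Relation.Binary.Permutation.Setoid as Permₛ
import Data.List.Relation.Binary.Permutation.Setoid.Properties as Permₛ
open import Data.List.Relation.Unary.Any using (here; there)
open import Data.Nat as ℕ using (zero; suc)
import Data.Nat.Coprimality as Coprime
import Data.Nat.Properties as ℕ
open import Data.Product as Product using (proj₁; proj₂)
open import Data.Rational as ℚ using (mkℚ; ↥_; ↧_; 1ℚ; _+_; -_; _<_; ceiling; toℚᵘ; *≤*; *<*)
open import Data.Rational.Properties
import Data.Rational.Solver as ℚSolver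
import Data.Rational.Unnormalised as ℚᵘ
import Data.Rational.Unnormalised.Properties as ℚᵘ
open import Data.Unit using (tt)
open import Function.Bundles using (Inverse)
open import Relation.Nullary using (¬_; Dec; yes; no)
open import Relation.Binary.PropositionalEquality
  using (_≢_; refl; sym; trans; cong; cong₂; subst; subst₂; setoid; module ≡-Reasoning)
open import Algebra.Properties.CommutativeSemigroup (CommutativeMonoid.commutativeSemigroup +-0-commutativeMonoid)
  using () renaming (interchange to +-interchange)

toℚ≡mkℚ : ∀ z → toℚ z ≡ mkℚ z 0 (Coprime.sym (Coprime.1-coprimeTo ℤ.∣ z ∣))
toℚ≡mkℚ (+ n)    = normalize-coprime {n} {0} _
toℚ≡mkℚ -[1+ n ] = cong -_ (normalize-coprime {suc n} {0} _)

↥toℚ : ∀ z → ↥ toℚ z ≡ z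
↥toℚ z = cong ↥_ (toℚ≡mkℚ z)

↧toℚ : ∀ z → ↧ toℚ z ≡ + 1
↧toℚ z = cong ↧_ (toℚ≡mkℚ z)

toℚ-suc : ∀ m → toℚ (+ suc m) ≡ toℚ (+ m) + 1ℚ
toℚ-suc m = toℚᵘ-injective (begin
  toℚᵘ (toℚ (+ suc m))             ≡⟨ cong toℚᵘ (toℚ≡mkℚ (+ suc m)) ⟩
  ℚᵘ.mkℚᵘ (+ suc m) 0              ≈⟨ ℚᵘ.*≡* (solve 1 (λ m → (con (+ 1) :+ m) :* con (+ 1)
                                         := (m :* con (+ 1) :+ con (+ 1) :* con (+ 1)) :* con (+ 1)) refl (+ m)) ⟩
  ℚᵘ.mkℚᵘ (+ m) 0 ℚᵘ.+ ℚᵘ.1ℚᵘ      ≡⟨ cong (λ p → toℚᵘ p ℚᵘ.+ ℚᵘ.1ℚᵘ) (toℚ≡mkℚ (+ m)) ⟨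
  toℚᵘ (toℚ (+ m)) ℚᵘ.+ toℚᵘ 1ℚ    ≈⟨ toℚᵘ-homo-+ (toℚ (+ m)) 1ℚ ⟨
  toℚᵘ (toℚ (+ m) + 1ℚ)            ∎)
  where
  open ℚᵘ.≃-Reasoning
  open ℤSolver.+-*-Solver

ceiling≡ : ∀ p → ceiling p ≡ ℤ.- ((ℤ.- ↥ p) ℤ./ ↧ p)
ceiling≡ (mkℚ -[1+ _ ]  _ _) = refl
ceiling≡ (mkℚ (+ 0)     _ _) = refl
ceiling≡ (mkℚ (+ suc _) _ _) = refl

p≤⌈p⌉ : ∀ p → p ≤ toℚ (ceiling p)
p≤⌈p⌉ p@(mkℚ n k _) = *≤* (begin
  n ℤ.* ↧ toℚ (ceiling p)     ≡⟨ cong (n ℤ.*_) (↧toℚ (ceiling p)) ⟩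
  n ℤ.* + 1                   ≡⟨ ℤ.*-identityʳ n ⟩
  n                           ≡⟨ ℤ.neg-involutive n ⟨
  ℤ.- (ℤ.- n)                 ≤⟨ ℤ.neg-mono-≤ (ℤ.[n/d]*d≤n (ℤ.- n) d) ⟩
  ℤ.- ((ℤ.- n ℤ./ d) ℤ.* d)   ≡⟨ ℤ.neg-distribˡ-* (ℤ.- n ℤ./ d) d ⟩
  ℤ.- (ℤ.- n ℤ./ d) ℤ.* d     ≡⟨ cong (ℤ._* d) (ceiling≡ p) ⟨
  ceiling p ℤ.* d             ≡⟨ cong (ℤ._* d) (↥toℚ (ceiling p)) ⟨
  ↥ toℚ (ceiling p) ℤ.* ↧ p   ∎)
  where
  d = + suc k
  open ℤ.≤-Reasoning

0<toℚ⇒1≤toℚ : ∀ z → 0ℚ < toℚ z → 1ℚ ≤ toℚ z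
0<toℚ⇒1≤toℚ z (*<* 0<z) = *≤* (begin
  + 1 ℤ.* ↧ toℚ z   ≡⟨ cong (+ 1 ℤ.*_) (↧toℚ z) ⟩
  + 1               ≤⟨ ℤ.i<j⇒suc[i]≤j (subst (+ 0 ℤ.<_) (trans (ℤ.*-identityʳ _) (↥toℚ z)) 0<z) ⟩
  z                 ≡⟨ trans (ℤ.*-identityʳ (↥ toℚ z)) (↥toℚ z) ⟨
  ↥ toℚ z ℤ.* + 1   ∎)
  where open ℤ.≤-Reasoning

1≤⌈p⌉ : ∀ {p} → 0ℚ < p → 1ℚ ≤ toℚ (ceiling p)
1≤⌈p⌉ {p} 0<p = 0<toℚ⇒1≤toℚ (ceiling p) (<-≤-trans 0<p (p≤⌈p⌉ p))

≤-from-slack : ∀ {x y} d → 0ℚ ≤ d → y ≡ x + d → x ≤ y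
≤-from-slack {x} d 0≤d refl = subst (_≤ x + d) (+-identityʳ x) (+-monoʳ-≤ x 0≤d)

p≤q⇒0≤q-p : ∀ {p q} → p ≤ q → 0ℚ ≤ q - p
p≤q⇒0≤q-p {p} {q} p≤q = subst (_≤ q - p) (+-inverseʳ p) (+-monoˡ-≤ (- p) p≤q)

*-nonNeg : ∀ {p q} → 0ℚ ≤ p → 0ℚ ≤ q → 0ℚ ≤ p * q
*-nonNeg {p} {q} 0≤p 0≤q = subst (_≤ p * q) (*-zeroʳ p) (*-monoˡ-≤-nonNeg p {{ℚ.nonNegative 0≤p}} 0≤q)

nonNeg-scaled : ∀ c .{{_ : ℚ.NonNegative c}} {p q} → p ≤ q → 0ℚ ≤ c * (q - p)
nonNeg-scaled c p≤q = *-nonNeg (nonNegative⁻¹ c) (p≤q⇒0≤q-p p≤q)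

2*-mono-≤ : ∀ {p q} → p ≤ q → (+ 2 / 1) * p ≤ (+ 2 / 1) * q
2*-mono-≤ = *-monoˡ-≤-nonNeg (+ 2 / 1)

module _ {A : Set} where

  nth-lookup : ∀ (xs : List A) i → nth xs (toℕ i) ≡ just (lookup xs i)
  nth-lookup (x ∷ xs) zero    = refl
  nth-lookup (x ∷ xs) (suc i) = nth-lookup xs i

  nth⇒lookup : ∀ (xs : List A) m {x} → nth xs m ≡ just x → ∃[ i ] toℕ i ≡ m × lookup xs i ≡ x
  nth⇒lookup (x ∷ xs) zero    refl = zero , refl , refl
  nth⇒lookup (x ∷ xs) (suc m) eq with nth⇒lookup xs m eq
  ... | i , refl , xᵢ = suc i , refl , xᵢ

  record Positions (xs ys : List A) : Set where
    field
      pos            : Fin (length ys) → ℕ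
      pos-injective  : ∀ {k k′} → pos k ≡ pos k′ → k ≡ k′
      nth-pos        : ∀ k → nth xs (pos k) ≡ just (lookup ys k)
      pos-surjective : ∀ m {x} → nth xs m ≡ just x → ∃[ k ] m ≡ pos k × x ≡ lookup ys k

  ↭⇒Positions : ∀ {xs ys} → xs ↭ ys → Positions xs ys
  ↭⇒Positions {xs} {ys} xs↭ys = record
    { pos            = λ k → toℕ (from k)
    ; pos-injective  = λ {k} {k′} eq →
        trans (sym (strictlyInverseˡ k)) (trans (cong to (toℕ-injective eq)) (strictlyInverseˡ k′))
    ; nth-pos        = λ k → trans (nth-lookup xs (from k)) (cong just (lookup-from k))
    ; pos-surjective = surjective
    }
    where
    open Inverse (Permₛ.onIndices (↭⇒↭ₛ xs↭ys)) using (to; from; strictlyInverseˡ; strictlyInverseʳ)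
    lookup-from : ∀ k → lookup xs (from k) ≡ lookup ys k
    lookup-from k = trans (Permₛ.onIndices-lookup (setoid A) (↭⇒↭ₛ xs↭ys) (from k)) (cong (lookup ys) (strictlyInverseˡ k))
    surjective : ∀ m {x} → nth xs m ≡ just x → ∃[ k ] m ≡ toℕ (from k) × x ≡ lookup ys k
    surjective m eq with nth⇒lookup xs m eq
    ... | i , refl , refl = to i , cong toℕ (sym (strictlyInverseʳ i)) ,
                            trans (cong (lookup xs) (sym (strictlyInverseʳ i))) (lookup-from (to i))

module Positions₃ {A : Set} {xs : List A} {x₀ x₁ x₂ : A} (P : Positions xs (x₀ ∷ x₁ ∷ x₂ ∷ [])) where
  open Positions P public

  j₀ j₁ j₂ : ℕ
  j₀ = pos zero
  j₁ = pos (suc zero)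
  j₂ = pos (suc (suc zero))

  nth-j₀ : nth xs j₀ ≡ just x₀
  nth-j₀ = nth-pos zero
  nth-j₁ : nth xs j₁ ≡ just x₁
  nth-j₁ = nth-pos (suc zero)
  nth-j₂ : nth xs j₂ ≡ just x₂
  nth-j₂ = nth-pos (suc (suc zero))

  j₀≢j₂ : j₀ ≢ j₂
  j₀≢j₂ eq with () ← pos-injective eq
  j₁≢j₂ : j₁ ≢ j₂
  j₁≢j₂ eq with () ← pos-injective eq

sumℚ-↭ : ∀ {xs ys} → xs ↭ ys → sumℚ xs ≡ sumℚ ys
sumℚ-↭ {xs} {ys} xs↭ys =
  trans (sumℚ≡foldr xs) (trans (Permₛ.foldr-commMonoid (setoid ℚ) +-0-isCommutativeMonoid (↭⇒↭ₛ xs↭ys)) (sym (sumℚ≡foldr ys)))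
  where
  sumℚ≡foldr : ∀ xs → sumℚ xs ≡ foldr _+_ 0ℚ xs
  sumℚ≡foldr []       = refl
  sumℚ≡foldr (x ∷ xs) = cong (λ s → x + s) (sumℚ≡foldr xs)

sumℚ-map₃ : ∀ {A : Set} {xs : List A} {x₀ x₁ x₂ : A} (f : A → ℚ) → xs ↭ (x₀ ∷ x₁ ∷ x₂ ∷ []) →
  sumℚ (map f xs) ≡ f x₀ + f x₁ + f x₂
sumℚ-map₃ {x₀ = x₀} {x₁} {x₂} f xs↭ = trans (sumℚ-↭ (map⁺ f xs↭))
  (solve 3 (λ a b c → a :+ (b :+ (c :+ con 0ℚ)) := a :+ b :+ c) refl (f x₀) (f x₁) (f x₂))
  where open ℚSolver.+-*-Solver

sumℚ-map-≤ : ∀ {A B : Set} (f : B → ℚ) (h : A → B) (g : A → ℚ) xs →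
  (∀ x → f (h x) ≤ g x) → sumℚ (map f (map h xs)) ≤ sumℚ (map g xs)
sumℚ-map-≤ f h g []       _   = ≤-refl
sumℚ-map-≤ f h g (x ∷ xs) f≤g = +-mono-≤ (f≤g x) (sumℚ-map-≤ f h g xs f≤g)

↭-regroup : ∀ {A : Set} (b t₁ t₂ : A) L₁ L₂ → b ∷ (L₁ ++ t₁ ∷ t₂ ∷ L₂) ↭ (L₁ ++ L₂) ++ t₁ ∷ t₂ ∷ b ∷ []
↭-regroup b t₁ t₂ L₁ L₂ = begin
  b ∷ (L₁ ++ t₁ ∷ t₂ ∷ L₂)               ↭⟨ prep b (++⁺ˡ L₁ (++-comm (t₁ ∷ t₂ ∷ []) L₂)) ⟩
  b ∷ (L₁ ++ L₂ ++ t₁ ∷ t₂ ∷ [])          ≡⟨ cong (b ∷_) (List.++-assoc L₁ L₂ _) ⟨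
  b ∷ ((L₁ ++ L₂) ++ t₁ ∷ t₂ ∷ [])        ↭⟨ ++-comm (b ∷ []) ((L₁ ++ L₂) ++ t₁ ∷ t₂ ∷ []) ⟩
  ((L₁ ++ L₂) ++ t₁ ∷ t₂ ∷ []) ++ b ∷ []  ≡⟨ List.++-assoc (L₁ ++ L₂) (t₁ ∷ t₂ ∷ []) (b ∷ []) ⟩
  (L₁ ++ L₂) ++ t₁ ∷ t₂ ∷ b ∷ []          ∎
  where open PermutationReasoning

NonNegL-nth : ∀ {cs j l t} → NonNegL cs → nth cs j ≡ just (l , t) → 0ℚ ≤ l × NonNeg t
NonNegL-nth {_ ∷ _} {zero}  (0≤l , t≥0 , _) refl = 0≤l , t≥0
NonNegL-nth {_ ∷ _} {suc j} (_ , _ , cs≥0)  eq   = NonNegL-nth cs≥0 eq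

AllVertL-nth : ∀ {Q cs j l t} → AllVertL Q cs → nth cs j ≡ just (l , t) → AllVert Q t
AllVertL-nth {cs = _ ∷ _} {zero}  (Qt , _)  refl = Qt
AllVertL-nth {cs = _ ∷ _} {suc j} (_ , Qcs) eq   = AllVertL-nth Qcs eq

AllVert-root : ∀ {Q} t → AllVert Q t → Q t
AllVert-root (node _ _) (Qt , _) = Qt

subtreeAt-child : ∀ q cs {j b} a → nth cs j ≡ just b → subtreeAt (node q cs) (j ∷ a) ≡ subtreeAt (proj₂ b) a
subtreeAt-child q cs a eq rewrite eq = refl

subtreeAt-child⁻¹ : ∀ q cs m a {w} → subtreeAt (node q cs) (m ∷ a) ≡ just w →
  ∃[ b ] nth cs m ≡ just b × subtreeAt (proj₂ b) a ≡ just w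
subtreeAt-child⁻¹ q cs m a eq with nth cs m
... | just b = b , refl , eq

subtreeAt-leaf : ∀ {t} a {w} → IsLeaf t → subtreeAt t a ≡ just w → a ≡ [] × w ≡ t
subtreeAt-leaf {node _ []} [] _ refl = refl , refl

total-leaf : ∀ {t} → IsLeaf t → total t ≡ dem t
total-leaf {node q []} refl = +-identityʳ q

totalL≡sum : ∀ cs → totalL cs ≡ sumℚ (map dB cs)
totalL≡sum []       = refl
totalL≡sum (c ∷ cs) = cong (λ s → dB c + s) (totalL≡sum cs)

total-node₃ : ∀ {q xs x₀ x₁ x₂} → q ≡ 0ℚ → xs ↭ (x₀ ∷ x₁ ∷ x₂ ∷ []) →
  total (node q xs) ≡ dB x₀ + dB x₁ + dB x₂
total-node₃ {xs = xs} refl xs↭ = trans (+-identityˡ (totalL xs)) (trans (totalL≡sum xs) (sumℚ-map₃ dB xs↭))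

branchLB : Branch → ℚ
branchLB (l , t) = (+ 2 / 1) * l * toℚ (traffic (l , t)) + LB t

LBL≡sum : ∀ cs → LBL cs ≡ sumℚ (map branchLB cs)
LBL≡sum []       = refl
LBL≡sum (c ∷ cs) = cong (λ s → branchLB c + s) (LBL≡sum cs)

LB-node₃ : ∀ {q xs x₀ x₁ x₂} → xs ↭ (x₀ ∷ x₁ ∷ x₂ ∷ []) → LB (node q xs) ≡ branchLB x₀ + branchLB x₁ + branchLB x₂
LB-node₃ {xs = xs} xs↭ = trans (LBL≡sum xs) (sumℚ-map₃ branchLB xs↭)

branchLB-leaf : ∀ b → 0ℚ ≤ len b → LeafB b → 0ℚ < dem (proj₂ b) → (+ 2 / 1) * len b ≤ branchLB b
branchLB-leaf (l , t@(node q [])) 0≤l refl 0<q =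
  ≤-from-slack ((+ 2 / 1) * l * (⌈q⌉ - 1ℚ))
    (*-nonNeg (*-nonNeg (nonNegative⁻¹ (+ 2 / 1)) 0≤l) (p≤q⇒0≤q-p (1≤⌈p⌉ (subst (0ℚ <_) (sym (total-leaf {t} refl)) 0<q))))
    (solve 2 (λ l c → con (+ 2 / 1) :* l :* c :+ con 0ℚ := con (+ 2 / 1) :* l :+ con (+ 2 / 1) :* l :* (c :- con 1ℚ)) refl l ⌈q⌉)
  where
  open ℚSolver.+-*-Solver
  ⌈q⌉ = toℚ (ceiling (total t))

mutual
  total-zeroDem : ∀ t → total (zeroDem t) ≡ 0ℚ
  total-zeroDem (node _ cs) = trans (+-identityˡ _) (totalL-zeroDemL cs)

  totalL-zeroDemL : ∀ cs → totalL (zeroDemL cs) ≡ 0ℚ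
  totalL-zeroDemL []             = refl
  totalL-zeroDemL ((_ , t) ∷ cs) = cong₂ _+_ (total-zeroDem t) (totalL-zeroDemL cs)

mutual
  LB-zeroDem : ∀ t → LB (zeroDem t) ≡ 0ℚ
  LB-zeroDem (node _ cs) = LBL-zeroDemL cs

  LBL-zeroDemL : ∀ cs → LBL (zeroDemL cs) ≡ 0ℚ
  LBL-zeroDemL []             = refl
  LBL-zeroDemL ((l , t) ∷ cs) rewrite total-zeroDem t | LB-zeroDem t | LBL-zeroDemL cs =
    trans (+-identityʳ _) (trans (+-identityʳ _) (*-zeroʳ ((+ 2 / 1) * l)))

LBL-zeroChild : ∀ cs i {b} → nth cs i ≡ just b → LBL cs ≡ LBL (zeroChild i cs) + branchLB b
LBL-zeroChild ((l , t) ∷ cs) zero refl rewrite total-zeroDem t | LB-zeroDem t =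
  solve 3 (λ l x y → x :+ y := con (+ 2 / 1) :* l :* con 0ℚ :+ con 0ℚ :+ y :+ x) refl l (branchLB (l , t)) (LBL cs)
  where open ℚSolver.+-*-Solver
LBL-zeroChild (c ∷ cs) (suc i) eq =
  trans (cong (λ s → branchLB c + s) (LBL-zeroChild cs i eq)) (sym (+-assoc (branchLB c) _ _))

LB-removeBranchDemand : ∀ q cs i {b} → nth cs i ≡ just b →
  LB (node q cs) - LB (removeBranchDemand (node q cs) i) ≡ branchLB b
LB-removeBranchDemand q cs i {b} eq rewrite LBL-zeroChild cs i eq =
  solve 2 (λ x y → x :+ y :- x := y) refl (LBL (zeroChild i cs)) (branchLB b)
  where open ℚSolver.+-*-Solver

↭₃⇒≢[] : ∀ {xs} {x₀ x₁ x₂ : Branch} → xs ↭ (x₀ ∷ x₁ ∷ x₂ ∷ []) → xs ≢ []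
↭₃⇒≢[] xs↭ refl with () ← ↭-length xs↭

LongChain⇒Chain : ∀ n {δ b} → LongChain (2 ℕ.+ n) δ b → Chain (2 ℕ.+ n) b
LongChain⇒Chain zero    chain       = chain
LongChain⇒Chain (suc n) (chain , _) = chain

Chain⇒traffic : ∀ n {b} → Chain (2 ℕ.+ n) b → traffic b ≡ + (2 ℕ.+ n)
Chain⇒traffic zero    (_ , f≡ , _) = f≡
Chain⇒traffic (suc n) (_ , f≡ , _) = f≡

Chain⇒¬leaf : ∀ n {s q xs} → Chain (2 ℕ.+ n) (s , node q xs) → ¬ IsLeaf (node q xs)
Chain⇒¬leaf zero    (_ , _ , _ , _ , _ , xs↭ , _) = ↭₃⇒≢[] xs↭
Chain⇒¬leaf (suc n) (_ , _ , _ , _ , _ , xs↭ , _) = ↭₃⇒≢[] xs↭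

leaves-match : ∀ {xs x₀ x₁ x₂ y₀ y₁ y₂} → xs ↭ (x₀ ∷ x₁ ∷ x₂ ∷ []) → xs ↭ (y₀ ∷ y₁ ∷ y₂ ∷ []) →
  ¬ LeafB x₀ → LeafB y₁ → LeafB y₂ → dB x₁ + dB x₂ ≡ dB y₁ + dB y₂
leaves-match {xs} {x₀} {x₁} {x₂} {y₀} {y₁} {y₂} xs↭x xs↭y ¬leaf₀ leaf₁ leaf₂
  with ∈-resp-↭ (↭-trans (↭-sym xs↭x) xs↭y) (here refl)
... | there (here refl)         = ⊥-elim (¬leaf₀ leaf₁)
... | there (there (here refl)) = ⊥-elim (¬leaf₀ leaf₂)
... | here refl = begin
  dB x₁ + dB x₂                  ≡⟨ solve 3 (λ a b c → b :+ c := a :+ b :+ c :- a) refl (dB x₀) (dB x₁) (dB x₂) ⟩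
  dB x₀ + dB x₁ + dB x₂ - dB x₀  ≡⟨ cong (_- dB x₀) (trans (sym (sumℚ-map₃ dB xs↭x)) (sumℚ-map₃ dB xs↭y)) ⟩
  dB x₀ + dB y₁ + dB y₂ - dB x₀  ≡⟨ solve 3 (λ a b c → a :+ b :+ c :- a := b :+ c) refl (dB x₀) (dB y₁) (dB y₂) ⟩
  dB y₁ + dB y₂                  ∎
  where
  open ≡-Reasoning
  open ℚSolver.+-*-Solver

liftTour : ℕ → Tour → Tour
liftTour j = map (Product.map₁ (j ∷_))

single : ℚ → Tour
single x = ([] , x) ∷ []

addresses : Tour → List Addr
addresses = map proj₁

load : Tour → ℚ
load τ = sumℚ (amounts τ)

addresses-lift : ∀ j τ → addresses (liftTour j τ) ≡ map (j ∷_) (addresses τ)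
addresses-lift j []      = refl
addresses-lift j (d ∷ τ) = cong ((j ∷ proj₁ d) ∷_) (addresses-lift j τ)

load-lift : ∀ j τ → load (liftTour j τ) ≡ load τ
load-lift j []      = refl
load-lift j (d ∷ τ) = cong (λ s → proj₂ d + s) (load-lift j τ)

liftTour-concat : ∀ j τ τs → liftTour j τ ++ concat (map (liftTour j) τs) ≡ liftTour j (concat (τ ∷ τs))
liftTour-concat j τ τs =
  trans (cong (liftTour j τ ++_) (List.concat-map τs)) (sym (List.map-++ _ τ (concat τs)))

deliveredTo-++ : ∀ a τ σ → deliveredTo a (τ ++ σ) ≡ deliveredTo a τ + deliveredTo a σ
deliveredTo-++ a []            σ = sym (+-identityˡ _)
deliveredTo-++ a ((b , x) ∷ τ) σ with List.≡-dec ℕ._≟_ a b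
... | yes _ = trans (cong (λ s → x + s) (deliveredTo-++ a τ σ)) (sym (+-assoc x _ _))
... | no  _ = deliveredTo-++ a τ σ

deliveredTo-↭ : ∀ a {τ σ} → τ ↭ σ → deliveredTo a τ ≡ deliveredTo a σ
deliveredTo-↭ a {τ} {σ} τ↭σ = trans (deliveredTo≡sum τ) (trans (sumℚ-↭ (map⁺ _ τ↭σ)) (sym (deliveredTo≡sum σ)))
  where
  deliveredTo≡sum : ∀ τ → deliveredTo a τ ≡ sumℚ (map (λ d → deliveredTo a (d ∷ [])) τ)
  deliveredTo≡sum []      = refl
  deliveredTo≡sum (d ∷ τ) =
    trans (deliveredTo-++ a (d ∷ []) τ) (cong (λ s → deliveredTo a (d ∷ []) + s) (deliveredTo≡sum τ))

deliveredTo-here : ∀ a x τ → deliveredTo a ((a , x) ∷ τ) ≡ x + deliveredTo a τ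
deliveredTo-here a x τ with List.≡-dec ℕ._≟_ a a
... | yes _   = refl
... | no  a≢a = ⊥-elim (a≢a refl)

deliveredTo-there : ∀ a b x τ → a ≢ b → deliveredTo a ((b , x) ∷ τ) ≡ deliveredTo a τ
deliveredTo-there a b x τ a≢b with List.≡-dec ℕ._≟_ a b
... | yes a≡b = ⊥-elim (a≢b a≡b)
... | no  _   = refl

deliveredTo-lift-same : ∀ j a τ → deliveredTo (j ∷ a) (liftTour j τ) ≡ deliveredTo a τ
deliveredTo-lift-same j a []            = refl
deliveredTo-lift-same j a ((b , x) ∷ τ) = byCases (List.≡-dec ℕ._≟_ a b)
  where
  byCases : Dec (a ≡ b) → deliveredTo (j ∷ a) (liftTour j ((b , x) ∷ τ)) ≡ deliveredTo a ((b , x) ∷ τ)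
  byCases (yes refl) = trans (deliveredTo-here (j ∷ a) x (liftTour j τ))
    (trans (cong (λ s → x + s) (deliveredTo-lift-same j a τ)) (sym (deliveredTo-here a x τ)))
  byCases (no a≢b)   = trans (deliveredTo-there (j ∷ a) (j ∷ b) x (liftTour j τ) (λ eq → a≢b (List.∷-injectiveʳ eq)))
    (trans (deliveredTo-lift-same j a τ) (sym (deliveredTo-there a b x τ a≢b)))

deliveredTo-lift-other : ∀ {m j} a τ → m ≢ j → deliveredTo (m ∷ a) (liftTour j τ) ≡ 0ℚ
deliveredTo-lift-other         a []            m≢j = refl
deliveredTo-lift-other {m} {j} a ((b , x) ∷ τ) m≢j =
  trans (deliveredTo-there (m ∷ a) (j ∷ b) x (liftTour j τ) (λ eq → m≢j (List.∷-injectiveˡ eq)))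
        (deliveredTo-lift-other a τ m≢j)

deliveredTo-lift-root : ∀ j τ → deliveredTo [] (liftTour j τ) ≡ 0ℚ
deliveredTo-lift-root j []            = refl
deliveredTo-lift-root j ((b , x) ∷ τ) =
  trans (deliveredTo-there [] (j ∷ b) x (liftTour j τ) (λ ())) (deliveredTo-lift-root j τ)

sumℚ-deliveredTo-lift : ∀ i a τs → sumℚ (map (deliveredTo (i ∷ a)) (map (liftTour i) τs)) ≡ deliveredTo a (concat τs)
sumℚ-deliveredTo-lift i a []       = refl
sumℚ-deliveredTo-lift i a (τ ∷ τs) =
  trans (cong₂ _+_ (deliveredTo-lift-same i a τ) (sumℚ-deliveredTo-lift i a τs)) (sym (deliveredTo-++ a τ (concat τs)))

Delivers : Tree → Tour → Set
Delivers t E = ∀ a w → subtreeAt t a ≡ just w → deliveredTo a E ≡ dem w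

Delivers-↭ : ∀ {t E E′} → E ↭ E′ → Delivers t E′ → Delivers t E
Delivers-↭ E↭E′ δ a w eq = trans (deliveredTo-↭ a E↭E′) (δ a w eq)

Delivers-leaf : ∀ {t} E → IsLeaf t → deliveredTo [] E ≡ dem t → Delivers t E
Delivers-leaf E leaf δ a w eq with subtreeAt-leaf a leaf eq
... | refl , refl = δ

module _ {xs : List Branch} {x₀ x₁ x₂ : Branch} (P : Positions xs (x₀ ∷ x₁ ∷ x₂ ∷ [])) where
  open Positions₃ P

  glue₃ : Tour → Tour → Tour → Tour
  glue₃ E₀ E₁ E₂ = liftTour j₀ E₀ ++ liftTour j₁ E₁ ++ liftTour j₂ E₂

  Delivers-node₃ : ∀ {q} E₀ E₁ E₂ → q ≡ 0ℚ →
    Delivers (proj₂ x₀) E₀ → Delivers (proj₂ x₁) E₁ → Delivers (proj₂ x₂) E₂ →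
    Delivers (node q xs) (glue₃ E₀ E₁ E₂)
  Delivers-node₃ {q} E₀ E₁ E₂ q≡0 δ₀ δ₁ δ₂ = delivers
    where
    split : ∀ a → deliveredTo a (glue₃ E₀ E₁ E₂) ≡
      deliveredTo a (liftTour j₀ E₀) + (deliveredTo a (liftTour j₁ E₁) + deliveredTo a (liftTour j₂ E₂))
    split a = trans (deliveredTo-++ a (liftTour j₀ E₀) _)
      (cong (λ s → deliveredTo a (liftTour j₀ E₀) + s) (deliveredTo-++ a (liftTour j₁ E₁) _))
    other : ∀ {k k′} a E → k ≢ k′ → deliveredTo (pos k ∷ a) (liftTour (pos k′) E) ≡ 0ℚ
    other a E k≢k′ = deliveredTo-lift-other a E (λ eq → k≢k′ (pos-injective eq))
    delivers : Delivers (node q xs) (glue₃ E₀ E₁ E₂)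
    delivers [] w refl = trans (split []) (trans
      (cong₂ _+_ (deliveredTo-lift-root _ E₀) (cong₂ _+_ (deliveredTo-lift-root _ E₁) (deliveredTo-lift-root _ E₂)))
      (sym q≡0))
    delivers (m ∷ a) w eq with subtreeAt-child⁻¹ q xs m a eq
    ... | b , nth≡ , sub with pos-surjective m nth≡
    ... | zero , refl , refl = trans (split _) (trans
      (cong₂ _+_ (deliveredTo-lift-same _ a E₀) (cong₂ _+_ (other a E₁ (λ ())) (other a E₂ (λ ()))))
      (trans (+-identityʳ _) (δ₀ a w sub)))
    ... | suc zero , refl , refl = trans (split _) (trans
      (cong₂ _+_ (other a E₀ (λ ())) (cong₂ _+_ (deliveredTo-lift-same _ a E₁) (other a E₂ (λ ()))))
      (trans (+-identityˡ _) (trans (+-identityʳ _) (δ₁ a w sub))))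
    ... | suc (suc zero) , refl , refl = trans (split _) (trans
      (cong₂ _+_ (other a E₀ (λ ())) (cong₂ _+_ (other a E₁ (λ ())) (deliveredTo-lift-same _ a E₂)))
      (trans (+-identityˡ _) (trans (+-identityˡ _) (δ₂ a w sub))))

ValidIn : Tree → Tour → Set
ValidIn t = AllDeliv (λ (a , x) → 0ℚ ≤ x × ∃[ w ] subtreeAt t a ≡ just w)

AllDeliv-map : ∀ {P Q : Addr × ℚ → Set} (f : Addr × ℚ → Addr × ℚ) {τ} →
  (∀ {d} → P d → Q (f d)) → AllDeliv P τ → AllDeliv Q (map f τ)
AllDeliv-map f {[]}    g _         = tt
AllDeliv-map f {_ ∷ τ} g (Pd , Pτ) = g Pd , AllDeliv-map f g Pτ

AllTours-map : ∀ {P Q : Tour → Set} (f : Tour → Tour) {τs} →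
  (∀ {τ} → P τ → Q (f τ)) → AllTours P τs → AllTours Q (map f τs)
AllTours-map f {[]}     g _          = tt
AllTours-map f {_ ∷ τs} g (Pτ , Pτs) = g Pτ , AllTours-map f g Pτs

ValidIn-single : ∀ t {x} → 0ℚ ≤ x → ValidIn t (single x)
ValidIn-single t 0≤x = (0≤x , t , refl) , tt

ValidIn-lift : ∀ q xs {j b} τ → nth xs j ≡ just b → ValidIn (proj₂ b) τ → ValidIn (node q xs) (liftTour j τ)
ValidIn-lift q xs τ eq = AllDeliv-map _ (λ { {a , _} (0≤x , w , sub) → 0≤x , w , trans (subtreeAt-child q xs a eq) sub })

ValidIn-leaf-++-lift : ∀ q xs {j k a b} x τ → nth xs j ≡ just a → nth xs k ≡ just b → 0ℚ ≤ x →
  ValidIn (proj₂ b) τ → ValidIn (node q xs) (liftTour j (single x) ++ liftTour k τ)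
ValidIn-leaf-++-lift q xs {a = a} x τ eqj eqk 0≤x valid =
  proj₁ (ValidIn-lift q xs (single x) eqj (ValidIn-single (proj₂ a) 0≤x)) , ValidIn-lift q xs τ eqk valid

ValidIn⇒TourInBranch : ∀ i t τ → ValidIn t τ → load τ ≤ 1ℚ → TourInBranch i t (liftTour i τ)
ValidIn⇒TourInBranch i t τ valid load≤1 =
  AllDeliv-map _ (λ { {a , _} (0≤x , w , sub) → 0≤x , a , w , refl , sub }) valid ,
  subst (_≤ 1ℚ) (sym (load-lift i τ)) load≤1

tailsWith-++ : ∀ i (as bs : List Addr) → tailsWith i (as ++ bs) ≡ tailsWith i as ++ tailsWith i bs
tailsWith-++ i []             bs = refl
tailsWith-++ i ([] ∷ as)      bs = tailsWith-++ i as bs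
tailsWith-++ i ((j ∷ a) ∷ as) bs with i ℕ.≟ j
... | yes _ = cong (a ∷_) (tailsWith-++ i as bs)
... | no  _ = tailsWith-++ i as bs

tailsWith-same : ∀ j (bs : List Addr) → tailsWith j (map (j ∷_) bs) ≡ bs
tailsWith-same j []       = refl
tailsWith-same j (b ∷ bs) with j ℕ.≟ j
... | yes _   = cong (b ∷_) (tailsWith-same j bs)
... | no  j≢j = ⊥-elim (j≢j refl)

tailsWith-other : ∀ {i j} (bs : List Addr) → i ≢ j → tailsWith i (map (j ∷_) bs) ≡ []
tailsWith-other         []       i≢j = refl
tailsWith-other {i} {j} (b ∷ bs) i≢j with i ℕ.≟ j
... | yes i≡j = ⊥-elim (i≢j i≡j)
... | no  _   = tailsWith-other bs i≢j

mutual
  spanLen-nonNeg : ∀ t as → NonNeg t → 0ℚ ≤ spanLen t as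
  spanLen-nonNeg (node _ cs) as (_ , cs≥0) = spanLenL-nonNeg 0 cs as cs≥0

  spanLenL-nonNeg : ∀ n cs as → NonNegL cs → 0ℚ ≤ spanLenL n cs as
  spanLenL-nonNeg n []             as _                  = ≤-refl
  spanLenL-nonNeg n ((l , t) ∷ cs) as (0≤l , t≥0 , cs≥0) =
    +-mono-≤ (edgeLen-nonNeg l t (tailsWith n as) 0≤l t≥0) (spanLenL-nonNeg (suc n) cs as cs≥0)

  edgeLen-nonNeg : ∀ l t as → 0ℚ ≤ l → NonNeg t → 0ℚ ≤ edgeLen l t as
  edgeLen-nonNeg l t []       0≤l t≥0 = ≤-refl
  edgeLen-nonNeg l t (a ∷ as) 0≤l t≥0 = +-mono-≤ 0≤l (spanLen-nonNeg t (a ∷ as) t≥0)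

mutual
  spanLen-++ : ∀ t as bs → NonNeg t → spanLen t (as ++ bs) ≤ spanLen t as + spanLen t bs
  spanLen-++ (node _ cs) as bs (_ , cs≥0) = spanLenL-++ 0 cs as bs cs≥0

  spanLenL-++ : ∀ n cs as bs → NonNegL cs → spanLenL n cs (as ++ bs) ≤ spanLenL n cs as + spanLenL n cs bs
  spanLenL-++ n []             as bs _ = ≤-reflexive (sym (+-identityʳ 0ℚ))
  spanLenL-++ n ((l , t) ∷ cs) as bs (0≤l , t≥0 , cs≥0) rewrite tailsWith-++ n as bs =
    ≤-trans (+-mono-≤ (edgeLen-++ l t (tailsWith n as) (tailsWith n bs) 0≤l t≥0) (spanLenL-++ (suc n) cs as bs cs≥0))
            (≤-reflexive (+-interchange (edgeLen l t (tailsWith n as)) (edgeLen l t (tailsWith n bs))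
                                        (spanLenL (suc n) cs as) (spanLenL (suc n) cs bs)))

  edgeLen-++ : ∀ l t as bs → 0ℚ ≤ l → NonNeg t → edgeLen l t (as ++ bs) ≤ edgeLen l t as + edgeLen l t bs
  edgeLen-++ l t []       bs       0≤l t≥0 = ≤-reflexive (sym (+-identityˡ _))
  edgeLen-++ l t (a ∷ as) []       0≤l t≥0 rewrite List.++-identityʳ as = ≤-reflexive (sym (+-identityʳ _))
  edgeLen-++ l t (a ∷ as) (b ∷ bs) 0≤l t≥0 =
    ≤-trans (+-monoʳ-≤ l (spanLen-++ t (a ∷ as) (b ∷ bs) t≥0))
            (≤-from-slack l 0≤l (solve 3 (λ l x y → (l :+ x) :+ (l :+ y) := (l :+ (x :+ y)) :+ l) refl l _ _))
    where open ℚSolver.+-*-Solver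

spanLenL-below : ∀ m cs {n} bs → n ℕ.< m → spanLenL m cs (map (n ∷_) bs) ≡ 0ℚ
spanLenL-below m []             bs n<m = refl
spanLenL-below m ((l , t) ∷ cs) bs n<m
  rewrite tailsWith-other {m} bs (ℕ.>⇒≢ n<m) | spanLenL-below (suc m) cs bs (ℕ.m<n⇒m<1+n n<m) = +-identityʳ 0ℚ

edgeLen≤ : ∀ l t bs → 0ℚ ≤ l → NonNeg t → edgeLen l t bs ≤ l + spanLen t bs
edgeLen≤ l t []       0≤l t≥0 = +-mono-≤ 0≤l (spanLen-nonNeg t [] t≥0)
edgeLen≤ l t (b ∷ bs) 0≤l t≥0 = ≤-refl

spanLenL-lift : ∀ n cs j {l t} bs → nth cs j ≡ just (l , t) → NonNegL cs →
  spanLenL n cs (map ((j ℕ.+ n) ∷_) bs) ≤ l + spanLen t bs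
spanLenL-lift n ((l , t) ∷ cs) zero bs refl (0≤l , t≥0 , _)
  rewrite tailsWith-same n bs | spanLenL-below (suc n) cs bs (ℕ.n<1+n n) | +-identityʳ (edgeLen l t bs) = edgeLen≤ l t bs 0≤l t≥0
spanLenL-lift n ((l′ , t′) ∷ cs) (suc j) {l} {t} bs eq (_ , _ , cs≥0)
  rewrite tailsWith-other {n} bs (ℕ.<⇒≢ (ℕ.s≤s (ℕ.m≤n+m n j))) | +-identityˡ (spanLenL (suc n) cs (map ((suc j ℕ.+ n) ∷_) bs)) =
  subst (λ k → spanLenL (suc n) cs (map (k ∷_) bs) ≤ l + spanLen t bs) (ℕ.+-suc j n) (spanLenL-lift (suc n) cs j bs eq cs≥0)

spanLen-lift : ∀ q cs j {l t} bs → nth cs j ≡ just (l , t) → NonNegL cs →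
  spanLen (node q cs) (map (j ∷_) bs) ≤ l + spanLen t bs
spanLen-lift q cs j {l} {t} bs eq cs≥0 =
  subst (λ k → spanLenL 0 cs (map (k ∷_) bs) ≤ l + spanLen t bs) (ℕ.+-identityʳ j) (spanLenL-lift 0 cs j bs eq cs≥0)

spanLen-root : ∀ t → spanLen t ([] ∷ []) ≡ 0ℚ
spanLen-root (node _ cs) = go 0 cs
  where
  go : ∀ n cs → spanLenL n cs ([] ∷ []) ≡ 0ℚ
  go n []       = refl
  go n (_ ∷ cs) = trans (+-identityˡ _) (go (suc n) cs)

-- The cost of the tour τ of t when the root of t lies at distance D from the depot.
costAt : ℚ → Tree → Tour → ℚ
costAt D t τ = (+ 2 / 1) * (D + spanLen t (addresses τ))

costAt-lift : ∀ D q xs j {s t} τ → nth xs j ≡ just (s , t) → NonNegL xs →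
  costAt D (node q xs) (liftTour j τ) ≤ costAt (D + s) t τ
costAt-lift D q xs j {s} {t} τ eq xs≥0 rewrite addresses-lift j τ =
  2*-mono-≤ (≤-trans (+-monoʳ-≤ D (spanLen-lift q xs j (addresses τ) eq xs≥0)) (≤-reflexive (sym (+-assoc D s _))))

costAt-leaf-++-lift : ∀ D q xs {j k l s t t′} x τ → nth xs j ≡ just (l , t) → nth xs k ≡ just (s , t′) → NonNeg (node q xs) →
  costAt D (node q xs) (liftTour j (single x) ++ liftTour k τ) ≤ (+ 2 / 1) * l + costAt (D + s) t′ τ
costAt-leaf-++-lift D q xs {j} {k} {l} {s} {t} {t′} x τ eqj eqk t≥0 = begin
  costAt D (node q xs) (liftTour j (single x) ++ liftTour k τ)
    ≡⟨ cong (λ as → (+ 2 / 1) * (D + spanLen (node q xs) as)) (List.map-++ proj₁ (liftTour j (single x)) (liftTour k τ)) ⟩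
  (+ 2 / 1) * (D + spanLen (node q xs) (addresses (liftTour j (single x)) ++ addresses (liftTour k τ)))
    ≤⟨ 2*-mono-≤ (+-monoʳ-≤ D (≤-trans (spanLen-++ _ (addresses (liftTour j (single x))) _ t≥0)
         (+-mono-≤ (spanLen-lift q xs j ([] ∷ []) eqj xs≥0)
                   (subst (λ as → spanLen (node q xs) as ≤ s + S) (sym (addresses-lift k τ))
                          (spanLen-lift q xs k (addresses τ) eqk xs≥0))))) ⟩
  (+ 2 / 1) * (D + ((l + spanLen t ([] ∷ [])) + (s + S)))
    ≡⟨ cong (λ z → (+ 2 / 1) * (D + ((l + z) + (s + S)))) (spanLen-root t) ⟩
  (+ 2 / 1) * (D + ((l + 0ℚ) + (s + S)))
    ≡⟨ solve 4 (λ D l s S → con (+ 2 / 1) :* (D :+ ((l :+ con 0ℚ) :+ (s :+ S)))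
                            := con (+ 2 / 1) :* l :+ con (+ 2 / 1) :* ((D :+ s) :+ S)) refl D l s S ⟩
  (+ 2 / 1) * l + costAt (D + s) t′ τ ∎
  where
  open ≤-Reasoning
  open ℚSolver.+-*-Solver
  S = spanLen t′ (addresses τ)
  xs≥0 = proj₂ t≥0

costAt-two-leaves : ∀ D q xs {j k l s t t′} x y → nth xs j ≡ just (l , t) → nth xs k ≡ just (s , t′) → NonNeg (node q xs) →
  costAt D (node q xs) (liftTour j (single x) ++ liftTour k (single y)) ≤ (+ 2 / 1) * (D + (l + s))
costAt-two-leaves D q xs {l = l} {s} {t′ = t′} x y eqj eqk t≥0 =
  ≤-trans (costAt-leaf-++-lift D q xs x (single y) eqj eqk t≥0) (≤-reflexive (begin
    (+ 2 / 1) * l + (+ 2 / 1) * ((D + s) + spanLen t′ ([] ∷ []))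
      ≡⟨ cong (λ z → (+ 2 / 1) * l + (+ 2 / 1) * ((D + s) + z)) (spanLen-root t′) ⟩
    (+ 2 / 1) * l + (+ 2 / 1) * ((D + s) + 0ℚ)
      ≡⟨ solve 3 (λ D l s → con (+ 2 / 1) :* l :+ con (+ 2 / 1) :* ((D :+ s) :+ con 0ℚ)
                          := con (+ 2 / 1) :* (D :+ (l :+ s))) refl D l s ⟩
    (+ 2 / 1) * (D + (l + s)) ∎))
  where
  open ≡-Reasoning
  open ℚSolver.+-*-Solver

-- Tours serving a chain t whose stem has traffic K and whose top vertex lies at distance D
-- from the depot; the carrier keeps R units of its capacity for demand collected above t.
record ChainTours (K D R : ℚ) (t : Tree) : Set where
  field
    carrier        : Tour
    fulls          : List Tour
    carrier-valid  : ValidIn t carrier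
    carrier-load   : R + load carrier ≤ 1ℚ
    fulls-feasible : AllTours (λ τ → ValidIn t τ × load τ ≤ 1ℚ) fulls
    delivers       : Delivers t (concat (carrier ∷ fulls))
    cost≤          : sumℚ (map (costAt D t) (carrier ∷ fulls)) ≤ (+ 4 / 3) * ((+ 2 / 1) * K * D + LB t)

  tours : List Tour
  tours = carrier ∷ fulls

module Fork {q xs x₀ x₁ x₂} (xs↭ : xs ↭ (x₀ ∷ x₁ ∷ x₂ ∷ [])) (verts : AllVert VertexOK (node q xs))
            (t≥0 : NonNeg (node q xs)) where
  P : Positions xs (x₀ ∷ x₁ ∷ x₂ ∷ [])
  P = ↭⇒Positions xs↭
  open Positions₃ P public

  vertex : VertexOK (node q xs)
  vertex = AllVert-root (node q xs) verts

  root-demand : q ≡ 0ℚ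
  root-demand = proj₁ (proj₂ vertex) (↭₃⇒≢[] xs↭)

  len≥0 : ∀ {j b} → nth xs j ≡ just b → 0ℚ ≤ len b
  len≥0 eq = proj₁ (NonNegL-nth (proj₂ t≥0) eq)

  demand∈ : ∀ {j b} → nth xs j ≡ just b → LeafB b → 0ℚ < dem (proj₂ b) × dem (proj₂ b) < 1ℚ
  demand∈ {b = b} eq = proj₁ (AllVert-root (proj₂ b) (AllVertL-nth (proj₂ verts) eq))

  leaf-branchLB : ∀ {j b} → nth xs j ≡ just b → LeafB b → (+ 2 / 1) * len b ≤ branchLB b
  leaf-branchLB {b = b} eq leaf = branchLB-leaf b (len≥0 eq) leaf (proj₁ (demand∈ eq leaf))

  leaves-overfill : ∀ {j k a b} → nth xs j ≡ just a → nth xs k ≡ just b → j ≢ k → LeafB a → LeafB b →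
    1ℚ < dem (proj₂ a) + dem (proj₂ b)
  leaves-overfill {a = a} {b} eqa eqb j≢k leafa leafb =
    subst₂ (λ u v → 1ℚ < u + v) (total-leaf {proj₂ a} leafa) (total-leaf {proj₂ b} leafb)
      (≰⇒> (λ ≤1 → ¬unite (_ , _ , a , b , j≢k , eqa , eqb , leafa , leafb , ≤1)))
    where ¬unite = proj₂ (proj₂ (proj₂ (proj₂ vertex)))

chain₂-cost-bound : ∀ {D a₀ a₁ a₂ g₀ g₁ g₂} → 0ℚ ≤ D → a₁ ≤ a₀ → a₂ ≤ a₁ →
  (+ 2 / 1) * a₀ ≤ g₀ → (+ 2 / 1) * a₁ ≤ g₁ → (+ 2 / 1) * a₂ ≤ g₂ →
  (+ 2 / 1) * (D + (a₀ + a₂)) + ((+ 2 / 1) * (D + (a₁ + a₂)) + 0ℚ)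
    ≤ (+ 4 / 3) * ((+ 2 / 1) * (+ 2 / 1) * D + (g₀ + g₁ + g₂))
chain₂-cost-bound {D} {a₀} {a₁} {a₂} {g₀} {g₁} {g₂} 0≤D a₁≤a₀ a₂≤a₁ g₀≥ g₁≥ g₂≥ =
  ≤-from-slack _
    (+-mono-≤ (+-mono-≤ (+-mono-≤ (+-mono-≤ (+-mono-≤
      (nonNeg-scaled (+ 4 / 3) g₀≥) (nonNeg-scaled (+ 4 / 3) g₁≥)) (nonNeg-scaled (+ 4 / 3) g₂≥))
      (nonNeg-scaled (+ 4 / 3) 0≤D)) (nonNeg-scaled (+ 2 / 3) (≤-trans a₂≤a₁ a₁≤a₀))) (nonNeg-scaled (+ 2 / 3) a₂≤a₁))
    (solve 7 (λ D a₀ a₁ a₂ g₀ g₁ g₂ →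
       con (+ 4 / 3) :* (con (+ 2 / 1) :* con (+ 2 / 1) :* D :+ (g₀ :+ g₁ :+ g₂))
       := (con (+ 2 / 1) :* (D :+ (a₀ :+ a₂)) :+ (con (+ 2 / 1) :* (D :+ (a₁ :+ a₂)) :+ con 0ℚ))
          :+ (con (+ 4 / 3) :* (g₀ :- con (+ 2 / 1) :* a₀) :+ con (+ 4 / 3) :* (g₁ :- con (+ 2 / 1) :* a₁)
              :+ con (+ 4 / 3) :* (g₂ :- con (+ 2 / 1) :* a₂) :+ con (+ 4 / 3) :* (D :- con 0ℚ)
              :+ con (+ 2 / 3) :* (a₀ :- a₂) :+ con (+ 2 / 3) :* (a₁ :- a₂)))
       refl D a₀ a₁ a₂ g₀ g₁ g₂)
  where open ℚSolver.+-*-Solver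

chain-step-cost-bound : ∀ {D s a b K L g₁ g₂ B S} → b ≤ D → b ≤ a →
  (+ 2 / 1) * a ≤ g₁ → (+ 2 / 1) * b ≤ g₂ →
  B + S ≤ (+ 4 / 3) * ((+ 2 / 1) * K * (D + s) + L) →
  ((+ 2 / 1) * b + B) + ((+ 2 / 1) * (D + (a + b)) + S)
    ≤ (+ 4 / 3) * ((+ 2 / 1) * (K + 1ℚ) * D + ((+ 2 / 1) * s * K + L + g₁ + g₂))
chain-step-cost-bound {D} {s} {a} {b} {K} {L} {g₁} {g₂} {B} {S} b≤D b≤a g₁≥ g₂≥ BS≤ =
  ≤-from-slack _
    (+-mono-≤ (+-mono-≤ (+-mono-≤ (+-mono-≤
      (nonNeg-scaled 1ℚ BS≤) (nonNeg-scaled (+ 4 / 3) g₁≥)) (nonNeg-scaled (+ 4 / 3) g₂≥))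
      (nonNeg-scaled (+ 2 / 3) b≤D)) (nonNeg-scaled (+ 2 / 3) b≤a))
    (solve 10 (λ D s a b K L g₁ g₂ B S →
       con (+ 4 / 3) :* (con (+ 2 / 1) :* (K :+ con 1ℚ) :* D :+ (con (+ 2 / 1) :* s :* K :+ L :+ g₁ :+ g₂))
       := ((con (+ 2 / 1) :* b :+ B) :+ (con (+ 2 / 1) :* (D :+ (a :+ b)) :+ S))
          :+ (con 1ℚ :* (con (+ 4 / 3) :* (con (+ 2 / 1) :* K :* (D :+ s) :+ L) :- (B :+ S))
              :+ con (+ 4 / 3) :* (g₁ :- con (+ 2 / 1) :* a) :+ con (+ 4 / 3) :* (g₂ :- con (+ 2 / 1) :* b)
              :+ con (+ 2 / 3) :* (D :- b) :+ con (+ 2 / 3) :* (a :- b)))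
       refl D s a b K L g₁ g₂ B S)
  where open ℚSolver.+-*-Solver

chain₂Tours : ∀ {δ s q xs R} → LongChain 2 δ (s , node q xs) → NonNeg (node q xs) → 0ℚ ≤ δ + s → 0ℚ ≤ R →
  R + total (node q xs) ≤ toℚ (+ 2) → ChainTours (toℚ (+ 2)) (δ + s) R (node q xs)
chain₂Tours {δ} {s} {q} {xs} {R} ((_ , verts) , _ , x₀ , x₁ , x₂ , xs↭ , leaf₀ , leaf₁ , leaf₂ , _ , _ , a₁≤a₀ , a₂≤a₁)
            t≥0 0≤D 0≤R total≤2 = record
  { carrier        = carrier
  ; fulls          = full ∷ []
  ; carrier-valid  = ValidIn-leaf-++-lift q xs d₀ (single y) nth-j₀ nth-j₂ (<⇒≤ (proj₁ (demand∈ nth-j₀ leaf₀)))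
                       (ValidIn-single _ 0≤y)
  ; carrier-load   = ≤-reflexive (solve 2 (λ d₀ R → R :+ (d₀ :+ ((con 1ℚ :- d₀ :- R) :+ con 0ℚ)) := con 1ℚ) refl d₀ R)
  ; fulls-feasible = ( ValidIn-leaf-++-lift q xs d₁ (single (d₂ - y)) nth-j₁ nth-j₂ (<⇒≤ (proj₁ (demand∈ nth-j₁ leaf₁)))
                         (ValidIn-single _ 0≤d₂-y)
                     , full-load) , tt
  ; delivers       = Delivers-↭ (prep _ (++-comm (_ ∷ []) full))
      (Delivers-node₃ P (single d₀) (single d₁) (single (d₂ - y) ++ single y) root-demand
        (Delivers-leaf (single d₀) leaf₀ (+-identityʳ d₀))
        (Delivers-leaf (single d₁) leaf₁ (+-identityʳ d₁))
        (Delivers-leaf (single (d₂ - y) ++ single y) leaf₂ (solve 2 (λ d₂ y → (d₂ :- y) :+ (y :+ con 0ℚ) := d₂) refl d₂ y)))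
  ; cost≤          = cost≤
  }
  where
  open ℚSolver.+-*-Solver
  open Fork xs↭ verts t≥0
  t = node q xs
  D = δ + s
  d₀ = dem (proj₂ x₀)
  d₁ = dem (proj₂ x₁)
  d₂ = dem (proj₂ x₂)
  total≤2′ : R + (d₀ + d₁ + d₂) ≤ + 2 / 1
  total≤2′ = subst (λ z → R + z ≤ + 2 / 1)
    (trans (total-node₃ root-demand xs↭)
      (cong₂ _+_ (cong₂ _+_ (total-leaf {proj₂ x₀} leaf₀) (total-leaf {proj₂ x₁} leaf₁)) (total-leaf {proj₂ x₂} leaf₂)))
    total≤2
  -- The carrier takes x₀ and fills up at x₂; the full tour takes x₁ and the rest of x₂.
  y = 1ℚ - d₀ - R
  0≤y : 0ℚ ≤ y
  0≤y = ≤-from-slack _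
    (+-mono-≤ (p≤q⇒0≤q-p total≤2′) (p≤q⇒0≤q-p (<⇒≤ (leaves-overfill nth-j₁ nth-j₂ j₁≢j₂ leaf₁ leaf₂))))
    (solve 4 (λ d₀ d₁ d₂ R → con 1ℚ :- d₀ :- R
                           := con 0ℚ :+ ((con (+ 2 / 1) :- (R :+ (d₀ :+ d₁ :+ d₂))) :+ ((d₁ :+ d₂) :- con 1ℚ)))
      refl d₀ d₁ d₂ R)
  0≤d₂-y : 0ℚ ≤ d₂ - y
  0≤d₂-y = ≤-from-slack _ (+-mono-≤ (p≤q⇒0≤q-p (<⇒≤ (leaves-overfill nth-j₀ nth-j₂ j₀≢j₂ leaf₀ leaf₂))) 0≤R)
    (solve 3 (λ d₀ d₂ R → d₂ :- (con 1ℚ :- d₀ :- R) := con 0ℚ :+ (((d₀ :+ d₂) :- con 1ℚ) :+ R)) refl d₀ d₂ R)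
  carrier full : Tour
  carrier = liftTour j₀ (single d₀) ++ liftTour j₂ (single y)
  full    = liftTour j₁ (single d₁) ++ liftTour j₂ (single (d₂ - y))
  full-load : load full ≤ 1ℚ
  full-load = ≤-from-slack _ (p≤q⇒0≤q-p total≤2′)
    (solve 4 (λ d₀ d₁ d₂ R → con 1ℚ
                           := (d₁ :+ ((d₂ :- (con 1ℚ :- d₀ :- R)) :+ con 0ℚ)) :+ (con (+ 2 / 1) :- (R :+ (d₀ :+ d₁ :+ d₂))))
      refl d₀ d₁ d₂ R)
  cost≤ : costAt D t carrier + (costAt D t full + 0ℚ) ≤ (+ 4 / 3) * ((+ 2 / 1) * toℚ (+ 2) * D + LB t)
  cost≤ = begin
    costAt D t carrier + (costAt D t full + 0ℚ)
      ≤⟨ +-mono-≤ (costAt-two-leaves D q xs d₀ y nth-j₀ nth-j₂ t≥0)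
                  (+-monoˡ-≤ 0ℚ (costAt-two-leaves D q xs d₁ (d₂ - y) nth-j₁ nth-j₂ t≥0)) ⟩
    (+ 2 / 1) * (D + (len x₀ + len x₂)) + ((+ 2 / 1) * (D + (len x₁ + len x₂)) + 0ℚ)
      ≤⟨ chain₂-cost-bound 0≤D a₁≤a₀ a₂≤a₁
           (leaf-branchLB nth-j₀ leaf₀) (leaf-branchLB nth-j₁ leaf₁) (leaf-branchLB nth-j₂ leaf₂) ⟩
    (+ 4 / 3) * ((+ 2 / 1) * (+ 2 / 1) * D + (branchLB x₀ + branchLB x₁ + branchLB x₂))
      ≡⟨ cong (λ L → (+ 4 / 3) * ((+ 2 / 1) * (+ 2 / 1) * D + L)) (LB-node₃ {q} xs↭) ⟨
    (+ 4 / 3) * ((+ 2 / 1) * toℚ (+ 2) * D + LB t) ∎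
    where open ≤-Reasoning

HasChainTours : ℕ → Set
HasChainTours n = ∀ {δ s q xs R} → LongChain (2 ℕ.+ n) δ (s , node q xs) → NonNeg (node q xs) →
  0ℚ ≤ δ + s → 0ℚ ≤ R → R + total (node q xs) ≤ toℚ (+ (2 ℕ.+ n)) →
  ChainTours (toℚ (+ (2 ℕ.+ n))) (δ + s) R (node q xs)

chainTours-step : ∀ n → HasChainTours n → HasChainTours (suc n)
chainTours-step n IH {δ} {s} {q} {xs} {R}
  (((_ , verts) , _ , y₀ , y₁ , y₂ , xs↭y , _ , leafy₁ , leafy₂ , 1<dy , _) ,
   x₀@(s′ , t′@(node q′ xs′)) , x₁ , x₂ , xs↭ , leaf₁ , leaf₂ , a₂≤a₁ , a₂<D , long₀)
  t≥0 0≤D 0≤R total≤K = record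
  { carrier        = carrier
  ; fulls          = T ∷ map (liftTour j₀) O.fulls
  ; carrier-valid  = ValidIn-leaf-++-lift q xs r O.carrier nth-j₂ nth-j₀ 0≤r O.carrier-valid
  ; carrier-load   = subst (λ z → R + (r + z) ≤ 1ℚ) (sym (load-lift j₀ O.carrier))
                       (subst (_≤ 1ℚ) (+-assoc R r (load O.carrier)) O.carrier-load)
  ; fulls-feasible =
      ( ValidIn-leaf-++-lift q xs d₁ (single (1ℚ - d₁)) nth-j₁ nth-j₂ (<⇒≤ (proj₁ d₁∈))
          (ValidIn-single _ (p≤q⇒0≤q-p (<⇒≤ (proj₂ d₁∈))))
      , ≤-reflexive (solve 1 (λ d → d :+ ((con 1ℚ :- d) :+ con 0ℚ) := con 1ℚ) refl d₁))
      , AllTours-map (liftTour j₀) (λ { {τ} (valid , load≤1) →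
          ValidIn-lift q xs τ nth-j₀ valid , subst (_≤ 1ℚ) (sym (load-lift j₀ τ)) load≤1 }) O.fulls-feasible
  ; delivers       = Delivers-↭ deliveries↭
      (Delivers-node₃ P (concat O.tours) (single d₁) (single (1ℚ - d₁) ++ single r) root-demand
        O.delivers
        (Delivers-leaf (single d₁) leaf₁ (+-identityʳ d₁))
        (Delivers-leaf (single (1ℚ - d₁) ++ single r) leaf₂
          (solve 2 (λ d₁ d₂ → (con 1ℚ :- d₁) :+ ((d₁ :+ d₂ :- con 1ℚ) :+ con 0ℚ) := d₂) refl d₁ d₂)))
  ; cost≤          = cost≤
  }
  where
  open ℚSolver.+-*-Solver
  open Fork xs↭ verts t≥0
  t = node q xs
  D = δ + s
  D′ = D + s′
  K′ = toℚ (+ (2 ℕ.+ n))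
  d₁ = dem (proj₂ x₁)
  d₂ = dem (proj₂ x₂)
  d₁∈ = demand∈ nth-j₁ leaf₁
  chain₀ = LongChain⇒Chain n long₀
  1<d₁+d₂ : 1ℚ < d₁ + d₂
  1<d₁+d₂ = subst₂ (λ u v → 1ℚ < u + v) (total-leaf {proj₂ x₁} leaf₁) (total-leaf {proj₂ x₂} leaf₂)
    (subst (1ℚ <_) (sym (leaves-match xs↭ xs↭y (Chain⇒¬leaf n chain₀) leafy₁ leafy₂)) 1<dy)
  -- What the full tour T cannot take from x₂ is left to the carrier of the (p-1)-chain.
  r = d₁ + d₂ - 1ℚ
  0≤r = p≤q⇒0≤q-p (<⇒≤ 1<d₁+d₂)
  total≤K′ : (R + r) + total t′ ≤ K′
  total≤K′ = ≤-from-slack _ (p≤q⇒0≤q-p (subst₂ (λ u v → R + u ≤ v) total≡ (toℚ-suc (2 ℕ.+ n)) total≤K))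
    (solve 5 (λ R T d₁ d₂ K → K := (R :+ (d₁ :+ d₂ :- con 1ℚ)) :+ T :+ ((K :+ con 1ℚ) :- (R :+ (T :+ d₁ :+ d₂))))
      refl R (total t′) d₁ d₂ K′)
    where
    total≡ : total t ≡ total t′ + d₁ + d₂
    total≡ = trans (total-node₃ root-demand xs↭)
      (cong₂ _+_ (cong (λ z → total t′ + z) (total-leaf {proj₂ x₁} leaf₁)) (total-leaf {proj₂ x₂} leaf₂))
  t′≥0 = NonNegL-nth (proj₂ t≥0) nth-j₀
  O = IH long₀ (proj₂ t′≥0) (+-mono-≤ 0≤D (proj₁ t′≥0)) (+-mono-≤ 0≤R 0≤r) total≤K′
  module O = ChainTours O
  T carrier : Tour
  T       = liftTour j₁ (single d₁) ++ liftTour j₂ (single (1ℚ - d₁))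
  carrier = liftTour j₂ (single r) ++ liftTour j₀ O.carrier
  deliveries↭ : concat (carrier ∷ T ∷ map (liftTour j₀) O.fulls) ↭
                glue₃ P (concat O.tours) (single d₁) (single (1ℚ - d₁) ++ single r)
  deliveries↭ = ↭-trans (↭-regroup b t₁ t₂ (liftTour j₀ O.carrier) (concat (map (liftTour j₀) O.fulls)))
    (↭-reflexive (cong (_++ t₁ ∷ t₂ ∷ b ∷ []) lifted))
    where
    b t₁ t₂ : Addr × ℚ
    b  = (j₂ ∷ [] , r)
    t₁ = (j₁ ∷ [] , d₁)
    t₂ = (j₂ ∷ [] , 1ℚ - d₁)
    lifted : liftTour j₀ O.carrier ++ concat (map (liftTour j₀) O.fulls) ≡ liftTour j₀ (concat O.tours)
    lifted = liftTour-concat j₀ O.carrier O.fulls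
  LB≡ : LB t ≡ (+ 2 / 1) * s′ * K′ + LB t′ + branchLB x₁ + branchLB x₂
  LB≡ = trans (LB-node₃ {q} xs↭)
    (cong (λ f → (+ 2 / 1) * s′ * toℚ f + LB t′ + branchLB x₁ + branchLB x₂) (Chain⇒traffic n chain₀))
  cost≤ : sumℚ (map (costAt D t) (carrier ∷ T ∷ map (liftTour j₀) O.fulls))
          ≤ (+ 4 / 3) * ((+ 2 / 1) * toℚ (+ (3 ℕ.+ n)) * D + LB t)
  cost≤ = begin
    costAt D t carrier + (costAt D t T + sumℚ (map (costAt D t) (map (liftTour j₀) O.fulls)))
      ≤⟨ +-mono-≤ (costAt-leaf-++-lift D q xs r O.carrier nth-j₂ nth-j₀ t≥0)
           (+-mono-≤ (costAt-two-leaves D q xs d₁ (1ℚ - d₁) nth-j₁ nth-j₂ t≥0)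
             (sumℚ-map-≤ (costAt D t) (liftTour j₀) (costAt D′ t′) O.fulls
               (λ τ → costAt-lift D q xs j₀ τ nth-j₀ (proj₂ t≥0)))) ⟩
    ((+ 2 / 1) * len x₂ + costAt D′ t′ O.carrier) + ((+ 2 / 1) * (D + (len x₁ + len x₂)) + sumℚ (map (costAt D′ t′) O.fulls))
      ≤⟨ chain-step-cost-bound {s = s′} {K = K′} {L = LB t′} (<⇒≤ a₂<D) a₂≤a₁
           (leaf-branchLB nth-j₁ leaf₁) (leaf-branchLB nth-j₂ leaf₂) O.cost≤ ⟩
    (+ 4 / 3) * ((+ 2 / 1) * (K′ + 1ℚ) * D + ((+ 2 / 1) * s′ * K′ + LB t′ + branchLB x₁ + branchLB x₂))
      ≡⟨ cong ((+ 4 / 3) *_) (cong₂ _+_ (cong (λ k → (+ 2 / 1) * k * D) (toℚ-suc (2 ℕ.+ n))) LB≡) ⟨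
    (+ 4 / 3) * ((+ 2 / 1) * toℚ (+ (3 ℕ.+ n)) * D + LB t) ∎
    where open ≤-Reasoning

chainTours : ∀ n → HasChainTours n
chainTours zero    {δ} {s} = chain₂Tours {δ} {s}
chainTours (suc n) {δ} {s} = chainTours-step n (chainTours n) {δ} {s}

ChainTours⇒CoversBranch : ∀ {K D t} i (O : ChainTours K D 0ℚ t) → CoversBranch i t (map (liftTour i) (ChainTours.tours O))
ChainTours⇒CoversBranch {t = t} i O =
  ( ValidIn⇒TourInBranch i t carrier carrier-valid (subst (_≤ 1ℚ) (+-identityˡ (load carrier)) carrier-load)
  , AllTours-map (liftTour i) (λ { {τ} (valid , load≤1) → ValidIn⇒TourInBranch i t τ valid load≤1 }) fulls-feasible )
  , λ a w sub → trans (sumℚ-deliveredTo-lift i a tours) (delivers a w sub)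
  where open ChainTours O

ChainTours-cost-at-root : ∀ {K l t d₀ cs i} → NonNeg (node d₀ cs) → nth cs i ≡ just (l , t) →
  (O : ChainTours K (0ℚ + l) 0ℚ t) →
  sumℚ (map (tourCost (node d₀ cs)) (map (liftTour i) (ChainTours.tours O))) ≤ (+ 4 / 3) * ((+ 2 / 1) * K * (0ℚ + l) + LB t)
ChainTours-cost-at-root {l = l} {t} {d₀} {cs} {i} R≥0 nth≡ O =
  ≤-trans (sumℚ-map-≤ (tourCost (node d₀ cs)) (liftTour i) (costAt (0ℚ + l) t) tours tourCost≤) cost≤
  where
  open ChainTours O
  tourCost≤ : ∀ τ → tourCost (node d₀ cs) (liftTour i τ) ≤ costAt (0ℚ + l) t τ
  tourCost≤ τ = subst (_≤ costAt (0ℚ + l) t τ)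
    (cong ((+ 2 / 1) *_) (+-identityˡ (spanLen (node d₀ cs) (addresses (liftTour i τ)))))
    (costAt-lift 0ℚ d₀ cs i τ nth≡ (proj₂ R≥0))

LB-removeBranchDemand-traffic : ∀ d₀ cs i {l t z} → nth cs i ≡ just (l , t) → traffic (l , t) ≡ z →
  (+ 2 / 1) * toℚ z * (0ℚ + l) + LB t ≡ LB (node d₀ cs) - LB (removeBranchDemand (node d₀ cs) i)
LB-removeBranchDemand-traffic d₀ cs i {l} {t} {z} nth≡ refl = trans
  (solve 3 (λ K l L → con (+ 2 / 1) :* K :* (con 0ℚ :+ l) :+ L := con (+ 2 / 1) :* l :* K :+ L) refl (toℚ z) l (LB t))
  (sym (LB-removeBranchDemand d₀ cs i nth≡))
  where open ℚSolver.+-*-Solver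

lemma4 : (d₀ : ℚ) (cs : List Branch) (i p : ℕ) (l : ℚ) (t : Tree) →
    NonNeg (node d₀ cs) →
    nth cs i ≡ just (l , t) →
    LongChain p 0ℚ (l , t) →
    ∃[ τs ] (CoversBranch i t τs ×
      (sumℚ (map (tourCost (node d₀ cs)) τs)
        ≤ (+ 4 / 3) * (LB (node d₀ cs) - LB (removeBranchDemand (node d₀ cs) i))))
lemma4 d₀ cs i zero          l t            _   _    ()
lemma4 d₀ cs i (suc zero)    l t            _   _    ()
lemma4 d₀ cs i (suc (suc n)) l t@(node _ _) R≥0 nth≡ long =
  map (liftTour i) tours , ChainTours⇒CoversBranch i O ,
  ≤-trans (ChainTours-cost-at-root R≥0 nth≡ O)
          (≤-reflexive (cong ((+ 4 / 3) *_) (LB-removeBranchDemand-traffic d₀ cs i nth≡ traffic≡)))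
  where
  traffic≡ = Chain⇒traffic n (LongChain⇒Chain n long)
  stem≥0 = NonNegL-nth (proj₂ R≥0) nth≡
  demand≤traffic : 0ℚ + total t ≤ toℚ (+ (2 ℕ.+ n))
  demand≤traffic = subst₂ _≤_ (sym (+-identityˡ (total t))) (cong toℚ traffic≡) (p≤⌈p⌉ (total t))
  O = chainTours n long (proj₂ stem≥0) (+-mono-≤ ≤-refl (proj₁ stem≥0)) ≤-refl demand≤traffic
  open ChainTours O using (tours)
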